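{- Let $\pi$ be an $\mathbf{LK}^{\mathrm{m}}$ proof of one of the following split sequents: (1) $\Gamma_1;\Gamma_2\Rightarrow\Delta_1;\Delta_2,\neg A$; (2) $\Gamma_1;\Gamma_2\Rightarrow\Delta_1,\neg A;\Delta_2$; (3) $\Gamma_1;\Gamma_2,\neg A\Rightarrow\Delta_1;\Delta_2$; (4) $\Gamma_1,\neg A;\Gamma_2\Rightarrow\Delta_1;\Delta_2$. Then there is an $\mathbf{LK}^{\mathrm{m}}$ proof $\pi'$ of, respectively, (1) $\Gamma_1;\Gamma_2,A\Rightarrow\Delta_1;\Delta_2$; (2) $\Gamma_1,A;\Gamma_2\Rightarrow\Delta_1;\Delta_2$; (3) $\Gamma_1;\Gamma_2\Rightarrow\Delta_1;\Delta_2,A$; (4) $\Gamma_1;\Gamma_2\Rightarrow\Delta_1,A;\Delta_2$, with $\mathcal{M}(\pi')=\mathcal{M}(\pi)$ and $|\pi'|\le 2|\pi|$.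
   Context: Propositional formulas are built from atoms and $\bot$ using $\wedge,\vee,\neg$; $V(A)$ denotes the set of atoms of $A$, extended to multisets by union. $|\pi|$ is the length (number of symbols) of a proof $\pi$. $\mathbf{LK}$ is the sequent calculus (sequents $\Gamma\Rightarrow\Delta$ with finite multisets) with axioms $p\Rightarrow p$ ($p$ an atom) and $\bot\Rightarrow$, and rules weakening, contraction (left/right), $(L\wedge_1),(L\wedge_2),(R\wedge),(R\vee_1),(R\vee_2),(L\vee),(L\neg)$ ($\Gamma\Rightarrow\Delta,A$ / $\neg A,\Gamma\Rightarrow\Delta$), $(R\neg)$ ($A,\Gamma\Rightarrow\Delta$ / $\Gamma\Rightarrow\Delta,\neg A$), and cut ($\Gamma\Rightarrow\Delta,A$ and $A,\Gamma\Rightarrow\Delta$ / $\Gamma\Rightarrow\Delta$), in standard Gentzen G1 form. A split sequent $\Gamma_1;\Gamma_2\Rightarrow\Delta_1;\Delta_2$ is the sequent $\Gamma_1,\Gamma_2\Rightarrow\Delta_1,\Delta_2$ with formulas divided into a left side ($\Gamma_1,\Delta_1$) and a right side ($\Gamma_2,\Delta_2$). In a proof of a split sequent every sequent is split, context formulas keep their side, and auxiliary formulas of a rule lie on the same side as its main formula; for a cut with conclusion $\Gamma_1;\Gamma_2\Rightarrow\Delta_1;\Delta_2$ and cut formula $A$, both occurrences of $A$ are placed on the left side (premises $\Gamma_1;\Gamma_2\Rightarrow\Delta_1,A;\Delta_2$ and $\Gamma_1,A;\Gamma_2\Rightarrow\Delta_1;\Delta_2$) or both on the right side (premises $\Gamma_1;\Gamma_2\Rightarrow\Delta_1;A,\Delta_2$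 and $\Gamma_1;\Gamma_2,A\Rightarrow\Delta_1;\Delta_2$). $\mathbf{LK}^{\mathrm{m}}$ (monochromatic cuts) allows a cut only if its cut formula is placed on the left side with $V(A)\subseteq V(\Gamma_1\cup\Delta_1)$ or on the right side with $V(A)\subseteq V(\Gamma_2\cup\Delta_2)$. The Maehara interpolant $\mathcal{M}(\pi)$: axioms $p;\Rightarrow p;$ give $\bot$, $;p\Rightarrow;p$ give $\top$, $p;\Rightarrow;p$ give $p$, $;p\Rightarrow p;$ give $\neg p$, $\bot;\Rightarrow;$ gives $\bot$, $;\bot\Rightarrow;$ gives $\top$; unary rules keep the interpolant of the premise; a binary rule ($(R\wedge)$, $(L\vee)$ or cut) with premise proofs $\pi_1,\pi_2$ gives $\mathcal{M}(\pi_1)\vee\mathcal{M}(\pi_2)$ if its main formula (for cut: the cut formula) is on the left side and $\mathcal{M}(\pi_1)\wedge\mathcal{M}(\pi_2)$ if on the right side. -}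

module Defs where

open import Data.Nat using (ℕ; zero; suc; _+_)
open import Data.List using (List; []; _∷_; _++_; [_])
open import Data.List.Membership.Propositional using (_∈_)
open import Data.List.Relation.Binary.Permutation.Propositional using (_↭_)

infixr 6 _∧'_
infixr 5 _∨'_
infix 7 ¬'_

data Formula : Set where
  atom : ℕ → Formula
  ⊥'   : Formula
  _∧'_ : Formula → Formula → Formula
  _∨'_ : Formula → Formula → Formula
  ¬'_  : Formula → Formula

⊤' : Formula
⊤' = ¬' ⊥'

-- V(A): the atoms of A (as a list; only membership matters).
V : Formula → List ℕ
V (atom p) = p ∷ []
V ⊥'       = []
V (A ∧' B) = V A ++ V B
V (A ∨' B) = V A ++ V B
V (¬' A)   = V A

Vs : List Formula → List ℕ
Vs []       = []
Vs (A ∷ Γ) = V A ++ Vs Γ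

-- Split sequents  Γ₁ ; Γ₂ ⇒ Δ₁ ; Δ₂  (multisets represented by lists;
-- the rule `exch` below identifies lists up to permutation).

data Side : Set where
  left right : Side

record SSeq : Set where
  constructor _︔_⇒_︔_
  field
    Γ₁ Γ₂ Δ₁ Δ₂ : List Formula
open SSeq public

addA : Side → Formula → SSeq → SSeq
addA left  A (Γ₁ ︔ Γ₂ ⇒ Δ₁ ︔ Δ₂) = (A ∷ Γ₁) ︔ Γ₂ ⇒ Δ₁ ︔ Δ₂
addA right A (Γ₁ ︔ Γ₂ ⇒ Δ₁ ︔ Δ₂) = Γ₁ ︔ (A ∷ Γ₂) ⇒ Δ₁ ︔ Δ₂

addS : Side → Formula → SSeq → SSeq
addS left  A (Γ₁ ︔ Γ₂ ⇒ Δ₁ ︔ Δ₂) = Γ₁ ︔ Γ₂ ⇒ (A ∷ Δ₁) ︔ Δ₂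
addS right A (Γ₁ ︔ Γ₂ ⇒ Δ₁ ︔ Δ₂) = Γ₁ ︔ Γ₂ ⇒ Δ₁ ︔ (A ∷ Δ₂)

sideVars : Side → SSeq → List ℕ
sideVars left  (Γ₁ ︔ Γ₂ ⇒ Δ₁ ︔ Δ₂) = Vs Γ₁ ++ Vs Δ₁
sideVars right (Γ₁ ︔ Γ₂ ⇒ Δ₁ ︔ Δ₂) = Vs Γ₂ ++ Vs Δ₂

_⊆ᵥ_ : List ℕ → List ℕ → Set
xs ⊆ᵥ ys = ∀ {x} → x ∈ xs → x ∈ ys

-- LK^m proofs of split sequents.  Every rule keeps context formulas on
-- their side; auxiliary formulas lie on the side of the main formula.
-- Cuts are monochromatic.

data LKm : SSeq → Set where
  ax-ll : ∀ p → LKm ([ atom p ] ︔ [] ⇒ [ atom p ] ︔ [])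
  ax-rr : ∀ p → LKm ([] ︔ [ atom p ] ⇒ [] ︔ [ atom p ])
  ax-lr : ∀ p → LKm ([ atom p ] ︔ [] ⇒ [] ︔ [ atom p ])
  ax-rl : ∀ p → LKm ([] ︔ [ atom p ] ⇒ [ atom p ] ︔ [])
  ax⊥-l : LKm ([ ⊥' ] ︔ [] ⇒ [] ︔ [])
  ax⊥-r : LKm ([] ︔ [ ⊥' ] ⇒ [] ︔ [])
  exch : ∀ {Γ₁ Γ₂ Δ₁ Δ₂ Γ₁' Γ₂' Δ₁' Δ₂'} →
         Γ₁ ↭ Γ₁' → Γ₂ ↭ Γ₂' → Δ₁ ↭ Δ₁' → Δ₂ ↭ Δ₂' →
         LKm (Γ₁ ︔ Γ₂ ⇒ Δ₁ ︔ Δ₂) → LKm (Γ₁' ︔ Γ₂' ⇒ Δ₁' ︔ Δ₂')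
  wL : ∀ {S} s A → LKm S → LKm (addA s A S)
  wR : ∀ {S} s A → LKm S → LKm (addS s A S)
  cL : ∀ {S} s A → LKm (addA s A (addA s A S)) → LKm (addA s A S)
  cR : ∀ {S} s A → LKm (addS s A (addS s A S)) → LKm (addS s A S)
  L∧₁ : ∀ {S} s A B → LKm (addA s A S) → LKm (addA s (A ∧' B) S)
  L∧₂ : ∀ {S} s A B → LKm (addA s B S) → LKm (addA s (A ∧' B) S)
  R∧  : ∀ {S} s A B → LKm (addS s A S) → LKm (addS s B S) → LKm (addS s (A ∧' B) S)
  R∨₁ : ∀ {S} s A B → LKm (addS s A S) → LKm (addS s (A ∨' B) S)
  R∨₂ : ∀ {S} s A B → LKm (addS s B S) → LKm (addS s (A ∨' B) S)
  L∨  : ∀ {S} s A B → LKm (addA s A S) → LKm (addA s B S) → LKm (addA s (A ∨' B) S)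
  L¬  : ∀ {S} s A → LKm (addS s A S) → LKm (addA s (¬' A) S)
  R¬  : ∀ {S} s A → LKm (addA s A S) → LKm (addS s (¬' A) S)
  cut : ∀ {S} s A → V A ⊆ᵥ sideVars s S →
        LKm (addS s A S) → LKm (addA s A S) → LKm S

join : Side → Formula → Formula → Formula
join left  I J = I ∨' J
join right I J = I ∧' J

M : ∀ {S} → LKm S → Formula
M (ax-ll p) = ⊥'
M (ax-rr p) = ⊤'
M (ax-lr p) = atom p
M (ax-rl p) = ¬' atom p
M ax⊥-l = ⊥'
M ax⊥-r = ⊤'
M (exch _ _ _ _ π) = M π
M (wL s A π) = M π
M (wR s A π) = M π
M (cL s A π) = M π
M (cR s A π) = M π
M (L∧₁ s A B π) = M π
M (L∧₂ s A B π) = M π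
M (R∧ s A B π₁ π₂) = join s (M π₁) (M π₂)
M (R∨₁ s A B π) = M π
M (R∨₂ s A B π) = M π
M (L∨ s A B π₁ π₂) = join s (M π₁) (M π₂)
M (L¬ s A π) = M π
M (R¬ s A π) = M π
M (cut s A _ π₁ π₂) = join s (M π₁) (M π₂)

fsize : Formula → ℕ
fsize (atom p) = 1
fsize ⊥'       = 1
fsize (A ∧' B) = suc (fsize A + fsize B)
fsize (A ∨' B) = suc (fsize A + fsize B)
fsize (¬' A)   = suc (fsize A)

lsize : List Formula → ℕ
lsize []      = 0
lsize (A ∷ Γ) = fsize A + lsize Γ

-- symbols of a sequent: its formulas plus the arrow
ssize : SSeq → ℕ
ssize (Γ₁ ︔ Γ₂ ⇒ Δ₁ ︔ Δ₂) = suc (lsize Γ₁ + lsize Γ₂ + lsize Δ₁ + lsize Δ₂)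

-- `exch` only identifies equal multisets, so it contributes nothing.
size : ∀ {S} → LKm S → ℕ
size {S} (ax-ll p) = ssize S
size {S} (ax-rr p) = ssize S
size {S} (ax-lr p) = ssize S
size {S} (ax-rl p) = ssize S
size {S} ax⊥-l = ssize S
size {S} ax⊥-r = ssize S
size (exch _ _ _ _ π) = size π
size {S} (wL s A π) = ssize S + size π
size {S} (wR s A π) = ssize S + size π
size {S} (cL s A π) = ssize S + size π
size {S} (cR s A π) = ssize S + size π
size {S} (L∧₁ s A B π) = ssize S + size π
size {S} (L∧₂ s A B π) = ssize S + size π
size {S} (R∧ s A B π₁ π₂) = ssize S + (size π₁ + size π₂)
size {S} (R∨₁ s A B π) = ssize S + size π
size {S} (R∨₂ s A B π) = ssize S + size π
size {S} (L∨ s A B π₁ π₂) = ssize S + (size π₁ + size π₂)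
size {S} (L¬ s A π) = ssize S + size π
size {S} (R¬ s A π) = ssize S + size π
size {S} (cut s A _ π₁ π₂) = ssize S + (size π₁ + size π₂)

-- Inversion of ¬A is proved by induction on the length of π, following the
-- last rule.  If the displayed ¬A is in the context of that rule, invert the
-- premises and reapply the rule (for a monochromatic cut the side condition
-- survives, as V(¬A) = V(A) and A stays on the side of ¬A).  If ¬A is principal,
-- the rule is a ¬-rule, whose premise is already the answer, or a weakening,
-- replaced by a weakening with A, or a contraction, where both copies are
-- inverted in turn.  Every sequent touched loses the symbol ¬, and every binary
-- rule and cut keeps its side, so M(π') = M(π) and even |π'| ≤ |π|.

module Submission where

open import Defs
open import Data.Bool using (true; false; if_then_else_)
open import Data.Empty using (⊥-elim)
open import Data.List using (List; []; _∷_; _++_; [_]; map)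
open import Data.List.Membership.Propositional using (_∈_; _∉_)
open import Data.List.Membership.Propositional.Properties using (∈-∃++)
open import Data.List.Relation.Unary.Any using (here; there)
open import Data.List.Relation.Binary.Permutation.Propositional as Perm
  using (_↭_; prep; swap; ↭-refl; ↭-sym; ↭-trans)
open import Data.List.Relation.Binary.Permutation.Propositional.Properties
  using (∈-resp-↭; drop-∷; shift; shifts; ++⁺; ++⁺ˡ; ++-assoc; map⁺)
open import Data.Nat using (ℕ; suc; _≤_; _<_; _*_; _+_; s≤s; z≤n)
open import Data.Nat.Induction using (<-wellFounded)
open import Data.Nat.ListAction using (sum)
open import Data.Nat.ListAction.Properties using (sum-↭)
open import Data.Nat.Properties
  using (≤-refl; ≤-trans; ≤-<-trans; <-≤-trans; <⇒≤; ≤-reflexive; +-assoc; +-suc; +-mono-≤; +-monoʳ-≤; m≤m+n; m≤n+m; m<n+m)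
open import Data.Product using (Σ; Σ-syntax; ∃-syntax; _×_; _,_; proj₁; proj₂)
open import Data.Product.Properties using (≡-dec)
open import Data.Sum using (_⊎_; inj₁; inj₂)
open import Induction.WellFounded using (Acc; acc)
open import Relation.Binary.Definitions using (DecidableEquality)
open import Relation.Binary.PropositionalEquality
  using (_≡_; refl; sym; trans; cong; cong₂; subst; subst₂; module ≡-Reasoning)
open import Relation.Nullary using (¬_; yes; no; does)
open import Relation.Nullary.Decidable using (dec-true)

data Polarity : Set where
  antecedent succedent : Polarity

Slot : Set
Slot = Side × Polarity

flip : Slot → Slot
flip (s , antecedent) = s , succedent
flip (s , succedent)  = s , antecedent

at : Slot → SSeq → List Formula
at (left  , antecedent) = Γ₁
at (right , antecedent) = Γ₂
at (left  , succedent)  = Δ₁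
at (right , succedent)  = Δ₂

add : Slot → Formula → SSeq → SSeq
add (s , antecedent) = addA s
add (s , succedent)  = addS s

adds : List (Slot × Formula) → SSeq → SSeq
adds []             S = S
adds ((q , B) ∷ Ps) S = add q B (adds Ps S)

_≟ˢ_ : DecidableEquality Side
left  ≟ˢ left  = yes refl
left  ≟ˢ right = no λ ()
right ≟ˢ left  = no λ ()
right ≟ˢ right = yes refl

_≟ᵖ_ : DecidableEquality Polarity
antecedent ≟ᵖ antecedent = yes refl
antecedent ≟ᵖ succedent  = no λ ()
succedent  ≟ᵖ antecedent = no λ ()
succedent  ≟ᵖ succedent  = yes refl

_≟_ : DecidableEquality Slot
_≟_ = ≡-dec _≟ˢ_ _≟ᵖ_

tabulate : (Slot → List Formula) → SSeq
tabulate f = f (left , antecedent) ︔ f (right , antecedent) ⇒ f (left , succedent) ︔ f (right , succedent)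

at-tabulate : ∀ f q → at q (tabulate f) ≡ f q
at-tabulate f (left  , antecedent) = refl
at-tabulate f (right , antecedent) = refl
at-tabulate f (left  , succedent)  = refl
at-tabulate f (right , succedent)  = refl

-- Defined through tabulate so that at-put holds without a case split on the two slots.
put : Slot → List Formula → SSeq → SSeq
put p Γ S = tabulate λ q → if does (p ≟ q) then Γ else at q S

at-put : ∀ p q Γ S → at q (put p Γ S) ≡ (if does (p ≟ q) then Γ else at q S)
at-put p q Γ S = at-tabulate (λ r → if does (p ≟ r) then Γ else at r S) q

add≡put : ∀ q B S → add q B S ≡ put q (B ∷ at q S) S
add≡put (left  , antecedent) B S = refl
add≡put (right , antecedent) B S = refl
add≡put (left  , succedent)  B S = refl
add≡put (right , succedent)  B S = refl

at-add : ∀ p q B S → at q (add p B S) ≡ (if does (p ≟ q) then B ∷ at q S else at q S)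
at-add p q B S rewrite add≡put p B S | at-put p q (B ∷ at p S) S with p ≟ q
... | yes refl = refl
... | no _     = refl

∈-at-add-here : ∀ q B S → B ∈ at q (add q B S)
∈-at-add-here q B S rewrite at-add q q B S | dec-true (q ≟ q) refl = here refl

∈-at-add : ∀ p q B S {C} → C ∈ at q (add p B S) → (p ≡ q × B ≡ C) ⊎ C ∈ at q S
∈-at-add p q B S m rewrite at-add p q B S with p ≟ q
... | no _ = inj₂ m
... | yes refl with m
...   | here C≡B = inj₁ (refl , sym C≡B)
...   | there m' = inj₂ m'

infix 4 _≅_
_≅_ : SSeq → SSeq → Set
S ≅ S' = ∀ q → at q S ↭ at q S'

≅-refl : ∀ {S} → S ≅ S
≅-refl _ = ↭-refl

≅-sym : ∀ {S S'} → S ≅ S' → S' ≅ S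
≅-sym e q = ↭-sym (e q)

≅-trans : ∀ {S S' S''} → S ≅ S' → S' ≅ S'' → S ≅ S''
≅-trans e f q = ↭-trans (e q) (f q)

≅-fields : ∀ {S S'} → Γ₁ S ↭ Γ₁ S' → Γ₂ S ↭ Γ₂ S' → Δ₁ S ↭ Δ₁ S' → Δ₂ S ↭ Δ₂ S' → S ≅ S'
≅-fields g₁ g₂ d₁ d₂ (left  , antecedent) = g₁
≅-fields g₁ g₂ d₁ d₂ (right , antecedent) = g₂
≅-fields g₁ g₂ d₁ d₂ (left  , succedent)  = d₁
≅-fields g₁ g₂ d₁ d₂ (right , succedent)  = d₂

exchange : ∀ {S S'} → S ≅ S' → LKm S → LKm S'
exchange e = exch (e (left , antecedent)) (e (right , antecedent)) (e (left , succedent)) (e (right , succedent))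

add-cong : ∀ q B {S S'} → S ≅ S' → add q B S ≅ add q B S'
add-cong q B {S} {S'} e r rewrite at-add q r B S | at-add q r B S' with does (q ≟ r)
... | true  = prep B (e r)
... | false = e r

add-comm : ∀ p q B C S → add p B (add q C S) ≅ add q C (add p B S)
add-comm p q B C S r
  rewrite at-add p r B (add q C S) | at-add q r C (add p B S) | at-add q r C S | at-add p r B S
  with does (p ≟ r) | does (q ≟ r)
... | true  | true  = swap B C ↭-refl
... | true  | false = ↭-refl
... | false | true  = ↭-refl
... | false | false = ↭-refl

add-cong-comm : ∀ q C p B {S R} → S ≅ add p B R → add q C S ≅ add p B (add q C R)
add-cong-comm q C p B {R = R} e = ≅-trans (add-cong q C e) (add-comm q p C B R)

adds-cong : ∀ Ps {S S'} → S ≅ S' → adds Ps S ≅ adds Ps S'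
adds-cong []             e = e
adds-cong ((q , B) ∷ Ps) e = add-cong q B (adds-cong Ps e)

adds-add-comm : ∀ Ps p A S → adds Ps (add p A S) ≅ add p A (adds Ps S)
adds-add-comm []             p A S = ≅-refl
adds-add-comm ((q , B) ∷ Ps) p A S = add-cong-comm q B p A (adds-add-comm Ps p A S)

add-cancel : ∀ q B {S S'} → add q B S ≅ add q B S' → S ≅ S'
add-cancel q B {S} {S'} e r with e r
... | e-r rewrite at-add q r B S | at-add q r B S' with does (q ≟ r)
... | true = drop-∷ e-r
... | false = e-r

∈⇒↭∷ : ∀ {C : Formula} {Γ} → C ∈ Γ → ∃[ Γ' ] Γ ↭ C ∷ Γ'
∈⇒↭∷ m with ∈-∃++ m
... | ys , zs , refl = ys ++ zs , shift _ ys zs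

∈-at⇒≅-add : ∀ q S {C} → C ∈ at q S → ∃[ R ] S ≅ add q C R
∈-at⇒≅-add q S {C} m with ∈⇒↭∷ m
... | Γ , S≅ = put q Γ S , slotwise
  where
  slotwise : S ≅ add q C (put q Γ S)
  slotwise r rewrite at-add q r C (put q Γ S) | at-put q r Γ S with q ≟ r
  ... | yes refl = S≅
  ... | no _     = ↭-refl

add-≅-add : ∀ {p q B C S S'} → add p B S ≅ add q C S' →
  (p ≡ q × B ≡ C × S ≅ S') ⊎ ∃[ R ] (S ≅ add q C R × S' ≅ add p B R)
add-≅-add {p} {q} {B} {C} {S} {S'} e
  with ∈-at-add p q B S (∈-resp-↭ (↭-sym (e q)) (∈-at-add-here q C S'))
... | inj₁ (refl , refl) = inj₁ (refl , refl , add-cancel p B e)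
... | inj₂ C∈S with ∈-at⇒≅-add q S C∈S
...   | R , S≅ = inj₂ (R , S≅ , add-cancel q C (≅-trans (≅-sym e) (≅-trans (add-cong p B S≅) (add-comm p q B C R))))

formulas : SSeq → List Formula
formulas S = Γ₁ S ++ Γ₂ S ++ Δ₁ S ++ Δ₂ S

formulas-≅ : ∀ {S S'} → S ≅ S' → formulas S ↭ formulas S'
formulas-≅ e = ++⁺ (e (left , antecedent)) (++⁺ (e (right , antecedent)) (++⁺ (e (left , succedent)) (e (right , succedent))))

formulas-add : ∀ q B S → formulas (add q B S) ↭ B ∷ formulas S
formulas-add (left  , antecedent) B S = ↭-refl
formulas-add (right , antecedent) B S = shift B (Γ₁ S) _
formulas-add (left  , succedent)  B S = ↭-trans (++⁺ˡ (Γ₁ S) (shift B (Γ₂ S) _)) (shift B (Γ₁ S) _)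
formulas-add (right , succedent)  B S =
  ↭-trans (++⁺ˡ (Γ₁ S) (++⁺ˡ (Γ₂ S) (shift B (Δ₁ S) _))) (formulas-add (left , succedent) B S)

∈-formulas : ∀ q B S {T} → T ≅ add q B S → B ∈ formulas T
∈-formulas q B S e = ∈-resp-↭ (↭-sym (↭-trans (formulas-≅ e) (formulas-add q B S))) (here refl)

lsize-++ : ∀ Γ Δ → lsize (Γ ++ Δ) ≡ lsize Γ + lsize Δ
lsize-++ []      Δ = refl
lsize-++ (B ∷ Γ) Δ = trans (cong (fsize B +_) (lsize-++ Γ Δ)) (sym (+-assoc (fsize B) (lsize Γ) (lsize Δ)))

lsize≡sum : ∀ Γ → lsize Γ ≡ sum (map fsize Γ)
lsize≡sum []      = refl
lsize≡sum (B ∷ Γ) = cong (fsize B +_) (lsize≡sum Γ)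

lsize-↭ : ∀ {Γ Δ} → Γ ↭ Δ → lsize Γ ≡ lsize Δ
lsize-↭ {Γ} {Δ} p = trans (lsize≡sum Γ) (trans (sum-↭ (map⁺ fsize p)) (sym (lsize≡sum Δ)))

ssize-formulas : ∀ S → ssize S ≡ suc (lsize (formulas S))
ssize-formulas (Γ₁ ︔ Γ₂ ⇒ Δ₁ ︔ Δ₂) = cong suc (begin
  lsize Γ₁ + lsize Γ₂ + lsize Δ₁ + lsize Δ₂     ≡⟨ +-assoc (lsize Γ₁ + lsize Γ₂) (lsize Δ₁) (lsize Δ₂) ⟩
  lsize Γ₁ + lsize Γ₂ + (lsize Δ₁ + lsize Δ₂)   ≡⟨ +-assoc (lsize Γ₁) (lsize Γ₂) _ ⟩
  lsize Γ₁ + (lsize Γ₂ + (lsize Δ₁ + lsize Δ₂)) ≡⟨ cong (λ n → lsize Γ₁ + (lsize Γ₂ + n)) (sym (lsize-++ Δ₁ Δ₂)) ⟩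
  lsize Γ₁ + (lsize Γ₂ + lsize (Δ₁ ++ Δ₂))      ≡⟨ cong (lsize Γ₁ +_) (sym (lsize-++ Γ₂ _)) ⟩
  lsize Γ₁ + lsize (Γ₂ ++ Δ₁ ++ Δ₂)             ≡⟨ sym (lsize-++ Γ₁ _) ⟩
  lsize (Γ₁ ++ Γ₂ ++ Δ₁ ++ Δ₂)                  ∎)
  where open ≡-Reasoning

ssize-≅ : ∀ {S S'} → S ≅ S' → ssize S ≡ ssize S'
ssize-≅ {S} {S'} e = trans (ssize-formulas S) (trans (cong suc (lsize-↭ (formulas-≅ e))) (sym (ssize-formulas S')))

ssize-add : ∀ q B S → ssize (add q B S) ≡ fsize B + ssize S
ssize-add q B S = begin
  ssize (add q B S)                   ≡⟨ ssize-formulas (add q B S) ⟩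
  suc (lsize (formulas (add q B S)))  ≡⟨ cong suc (lsize-↭ (formulas-add q B S)) ⟩
  suc (fsize B + lsize (formulas S))  ≡⟨ sym (+-suc (fsize B) _) ⟩
  fsize B + suc (lsize (formulas S))  ≡⟨ cong (fsize B +_) (sym (ssize-formulas S)) ⟩
  fsize B + ssize S                   ∎
  where open ≡-Reasoning

ssize-add-mono : ∀ q B {S S'} → ssize S ≤ ssize S' → ssize (add q B S) ≤ ssize (add q B S')
ssize-add-mono q B {S} {S'} le rewrite ssize-add q B S | ssize-add q B S' = +-monoʳ-≤ (fsize B) le

ssize-inverted : ∀ p A S {T} → T ≅ add p (¬' A) S → ssize (add (flip p) A S) < ssize T
ssize-inverted p A S {T} e = ≤-reflexive (begin
  suc (ssize (add (flip p) A S)) ≡⟨ cong suc (ssize-add (flip p) A S) ⟩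
  suc (fsize A + ssize S)        ≡⟨ sym (ssize-add p (¬' A) S) ⟩
  ssize (add p (¬' A) S)         ≡⟨ ssize-≅ (≅-sym e) ⟩
  ssize T                        ∎)
  where open ≡-Reasoning

<ssize+ : ∀ S n → n < ssize S + n
<ssize+ S n = m<n+m n (s≤s z≤n)

<ssize+ˡ : ∀ S m n → m < ssize S + (m + n)
<ssize+ˡ S m n = <-≤-trans (<ssize+ S m) (+-monoʳ-≤ (ssize S) (m≤m+n m n))

<ssize+ʳ : ∀ S m n → n < ssize S + (m + n)
<ssize+ʳ S m n = <-≤-trans (<ssize+ S n) (+-monoʳ-≤ (ssize S) (m≤n+m n m))

Vs-↭ : ∀ {Γ Δ} → Γ ↭ Δ → Vs Γ ↭ Vs Δ
Vs-↭ Perm.refl            = ↭-refl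
Vs-↭ (prep B p)           = ++⁺ˡ (V B) (Vs-↭ p)
Vs-↭ (swap B C p)         = ↭-trans (shifts (V B) (V C)) (++⁺ˡ (V C) (++⁺ˡ (V B) (Vs-↭ p)))
Vs-↭ (Perm.trans p q)     = ↭-trans (Vs-↭ p) (Vs-↭ q)

sideVars-≅ : ∀ s {S S'} → S ≅ S' → sideVars s S ↭ sideVars s S'
sideVars-≅ left  e = ++⁺ (Vs-↭ (e (left , antecedent))) (Vs-↭ (e (left , succedent)))
sideVars-≅ right e = ++⁺ (Vs-↭ (e (right , antecedent))) (Vs-↭ (e (right , succedent)))

sideVars-flip : ∀ s p A S → sideVars s (add p (¬' A) S) ↭ sideVars s (add (flip p) A S)
sideVars-flip left  (left  , antecedent) A S = ↭-trans (++-assoc (V A) _ _) (shifts (V A) (Vs (Γ₁ S)))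
sideVars-flip left  (left  , succedent)  A S = ↭-sym (sideVars-flip left (left , antecedent) A S)
sideVars-flip left  (right , antecedent) A S = ↭-refl
sideVars-flip left  (right , succedent)  A S = ↭-refl
sideVars-flip right (left  , antecedent) A S = ↭-refl
sideVars-flip right (left  , succedent)  A S = ↭-refl
sideVars-flip right (right , antecedent) A S = ↭-trans (++-assoc (V A) _ _) (shifts (V A) (Vs (Γ₂ S)))
sideVars-flip right (right , succedent)  A S = ↭-sym (sideVars-flip right (right , antecedent) A S)

data UnaryRule : Slot → Formula → List (Slot × Formula) → Set where
  weakening   : ∀ q B → UnaryRule q B []
  contraction : ∀ q B → UnaryRule q B ((q , B) ∷ (q , B) ∷ [])
  ∧-left₁     : ∀ s B C → UnaryRule (s , antecedent) (B ∧' C) [ (s , antecedent) , B ]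
  ∧-left₂     : ∀ s B C → UnaryRule (s , antecedent) (B ∧' C) [ (s , antecedent) , C ]
  ∨-right₁    : ∀ s B C → UnaryRule (s , succedent) (B ∨' C) [ (s , succedent) , B ]
  ∨-right₂    : ∀ s B C → UnaryRule (s , succedent) (B ∨' C) [ (s , succedent) , C ]
  negation    : ∀ q B → UnaryRule q (¬' B) [ flip q , B ]

unary : ∀ {q B Ps S} → UnaryRule q B Ps → LKm (adds Ps S) → LKm (add q B S)
unary (weakening   (s , antecedent) B) = wL s B
unary (weakening   (s , succedent)  B) = wR s B
unary (contraction (s , antecedent) B) = cL s B
unary (contraction (s , succedent)  B) = cR s B
unary (∧-left₁ s B C)                  = L∧₁ s B C
unary (∧-left₂ s B C)                  = L∧₂ s B C
unary (∨-right₁ s B C)                 = R∨₁ s B C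
unary (∨-right₂ s B C)                 = R∨₂ s B C
unary (negation    (s , antecedent) B) = L¬ s B
unary (negation    (s , succedent)  B) = R¬ s B

unary-M-size : ∀ {q B Ps S} (r : UnaryRule q B Ps) (π : LKm (adds Ps S)) →
  M (unary r π) ≡ M π × size (unary r π) ≡ ssize (add q B S) + size π
unary-M-size (weakening   (_ , antecedent) _) _ = refl , refl
unary-M-size (weakening   (_ , succedent)  _) _ = refl , refl
unary-M-size (contraction (_ , antecedent) _) _ = refl , refl
unary-M-size (contraction (_ , succedent)  _) _ = refl , refl
unary-M-size (∧-left₁ _ _ _)                  _ = refl , refl
unary-M-size (∧-left₂ _ _ _)                  _ = refl , refl
unary-M-size (∨-right₁ _ _ _)                 _ = refl , refl
unary-M-size (∨-right₂ _ _ _)                 _ = refl , refl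
unary-M-size (negation    (_ , antecedent) _) _ = refl , refl
unary-M-size (negation    (_ , succedent)  _) _ = refl , refl

unary-mono : ∀ {q B Ps S q' B' Ps' S'} (r : UnaryRule q B Ps) (r' : UnaryRule q' B' Ps')
  (π : LKm (adds Ps S)) (π' : LKm (adds Ps' S')) →
  M π' ≡ M π → ssize (add q' B' S') ≤ ssize (add q B S) → size π' ≤ size π →
  M (unary r' π') ≡ M (unary r π) × size (unary r' π') ≤ size (unary r π)
unary-mono r r' π π' M≡ ssize≤ size≤ with unary-M-size r π | unary-M-size r' π'
... | M-r , size-r | M-r' , size-r' =
  trans M-r' (trans M≡ (sym M-r)) , subst₂ _≤_ (sym size-r') (sym size-r) (+-mono-≤ ssize≤ size≤)

premise<unary : ∀ {q B Ps S} (r : UnaryRule q B Ps) (π : LKm (adds Ps S)) → size π < size (unary r π)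
premise<unary {q} {B} {S = S} r π =
  subst (size π <_) (sym (proj₂ (unary-M-size r π))) (<ssize+ (add q B S) (size π))

data BinaryRule : Slot → Formula → Formula → Formula → Set where
  ∧-right : ∀ s B C → BinaryRule (s , succedent) (B ∧' C) B C
  ∨-left  : ∀ s B C → BinaryRule (s , antecedent) (B ∨' C) B C

binary : ∀ {q B B₁ B₂ S} → BinaryRule q B B₁ B₂ → LKm (add q B₁ S) → LKm (add q B₂ S) → LKm (add q B S)
binary (∧-right s B C) = R∧ s B C
binary (∨-left  s B C) = L∨ s B C

binary-M-size : ∀ {q B B₁ B₂ S} (r : BinaryRule q B B₁ B₂) (π₁ : LKm (add q B₁ S)) (π₂ : LKm (add q B₂ S)) →
  M (binary r π₁ π₂) ≡ join (proj₁ q) (M π₁) (M π₂) ×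
  size (binary r π₁ π₂) ≡ ssize (add q B S) + (size π₁ + size π₂)
binary-M-size (∧-right _ _ _) _ _ = refl , refl
binary-M-size (∨-left  _ _ _) _ _ = refl , refl

binary-mono : ∀ {q B B₁ B₂ S S'} (r : BinaryRule q B B₁ B₂)
  (π₁ : LKm (add q B₁ S)) (π₂ : LKm (add q B₂ S)) (π₁' : LKm (add q B₁ S')) (π₂' : LKm (add q B₂ S')) →
  M π₁' ≡ M π₁ → M π₂' ≡ M π₂ → ssize (add q B S') ≤ ssize (add q B S) → size π₁' ≤ size π₁ → size π₂' ≤ size π₂ →
  M (binary r π₁' π₂') ≡ M (binary r π₁ π₂) × size (binary r π₁' π₂') ≤ size (binary r π₁ π₂)
binary-mono {q} r π₁ π₂ π₁' π₂' M₁ M₂ ssize≤ size₁ size₂ with binary-M-size r π₁ π₂ | binary-M-size r π₁' π₂'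
... | M-r , size-r | M-r' , size-r' =
  trans M-r' (trans (cong₂ (join (proj₁ q)) M₁ M₂) (sym M-r)) ,
  subst₂ _≤_ (sym size-r') (sym size-r) (+-mono-≤ ssize≤ (+-mono-≤ size₁ size₂))

premise<binaryˡ : ∀ {q B B₁ B₂ S} (r : BinaryRule q B B₁ B₂) (π₁ : LKm (add q B₁ S)) (π₂ : LKm (add q B₂ S)) →
  size π₁ < size (binary r π₁ π₂)
premise<binaryˡ {q} {B} {S = S} r π₁ π₂ =
  subst (size π₁ <_) (sym (proj₂ (binary-M-size r π₁ π₂))) (<ssize+ˡ (add q B S) (size π₁) (size π₂))

premise<binaryʳ : ∀ {q B B₁ B₂ S} (r : BinaryRule q B B₁ B₂) (π₁ : LKm (add q B₁ S)) (π₂ : LKm (add q B₂ S)) →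
  size π₂ < size (binary r π₁ π₂)
premise<binaryʳ {q} {B} {S = S} r π₁ π₂ =
  subst (size π₂ <_) (sym (proj₂ (binary-M-size r π₁ π₂))) (<ssize+ʳ (add q B S) (size π₁) (size π₂))

¬-not-binary : ∀ {q A B₁ B₂} → ¬ BinaryRule q (¬' A) B₁ B₂
¬-not-binary ()

¬'∉-atoms : ∀ {A x y} → ¬' A ∉ atom x ∷ atom y ∷ []
¬'∉-atoms (here ())
¬'∉-atoms (there (here ()))
¬'∉-atoms (there (there ()))

¬'∉-⊥ : ∀ {A} → ¬' A ∉ ⊥' ∷ []
¬'∉-⊥ (here ())
¬'∉-⊥ (there ())

module ¬-Inversion (p : Slot) (A : Formula) where

  Inverse : SSeq → ∀ {T} → LKm T → Set
  Inverse S π = Σ[ π' ∈ LKm (add (flip p) A S) ] M π' ≡ M π × size π' ≤ size π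

  -- Quantifying over every way of displaying ¬A in T absorbs the exchange rule.
  Invertible : ∀ {T} → LKm T → Set
  Invertible {T} π = ∀ {S} → T ≅ add p (¬' A) S → Inverse S π

  InvertibleBelow : ℕ → Set
  InvertibleBelow n = ∀ {T} (π : LKm T) → size π < n → Invertible π

  unary-principal : ∀ {Ps S₁ S} (r : UnaryRule p (¬' A) Ps) (π : LKm (adds Ps S₁)) →
    InvertibleBelow (size (unary r π)) → S₁ ≅ S → Inverse S (unary r π)
  unary-principal {S₁ = S₁} (weakening _ _) π _ S₁≅S =
    exchange (add-cong (flip p) A S₁≅S) (unary (weakening (flip p) A) π) ,
    unary-mono (weakening p (¬' A)) (weakening (flip p) A) π π refl (<⇒≤ (ssize-inverted p A S₁ ≅-refl)) ≤-refl
  unary-principal {S₁ = S₁} (contraction _ _) π ih S₁≅S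
    with ih π (premise<unary (contraction p (¬' A)) π) ≅-refl
  ... | π₁ , M₁ , size₁
    with ih π₁ (≤-<-trans size₁ (premise<unary (contraction p (¬' A)) π)) (add-comm (flip p) p A (¬' A) S₁)
  ... | π₂ , M₂ , size₂ =
    exchange (add-cong (flip p) A S₁≅S) (unary (contraction (flip p) A) π₂) ,
    unary-mono (contraction p (¬' A)) (contraction (flip p) A) π π₂
      (trans M₂ M₁) (<⇒≤ (ssize-inverted p A S₁ ≅-refl)) (≤-trans size₂ size₁)
  unary-principal (negation _ _) π _ S₁≅S =
    exchange (add-cong (flip p) A S₁≅S) π ,
    sym (proj₁ (unary-M-size (negation p A) π)) , <⇒≤ (premise<unary (negation p A) π)

  unary-context : ∀ {q B Ps S₁ S R} (r : UnaryRule q B Ps) (π : LKm (adds Ps S₁)) → Invertible π →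
    S₁ ≅ add p (¬' A) R → S ≅ add q B R → Inverse S (unary r π)
  unary-context {q} {B} {Ps} {R = R} r π inv S₁≅ S≅
    with inv (≅-trans (adds-cong Ps S₁≅) (adds-add-comm Ps p (¬' A) R))
  ... | π' , M≡ , size≤ =
    exchange (≅-sym (add-cong-comm (flip p) A q B S≅)) (unary r π'') ,
    unary-mono r r π π'' M≡ (ssize-add-mono q B (<⇒≤ (ssize-inverted p A R S₁≅))) size≤
    where
    π'' : LKm (adds Ps (add (flip p) A R))
    π'' = exchange (≅-sym (adds-add-comm Ps (flip p) A R)) π'

  unary-invertible : ∀ {q B Ps S₁} (r : UnaryRule q B Ps) (π : LKm (adds Ps S₁)) →
    InvertibleBelow (size (unary r π)) → Invertible (unary r π)
  unary-invertible {q} {B} {S₁ = S₁} r π ih {S} e with add-≅-add {q} {p} {B} {¬' A} {S₁} {S} e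
  ... | inj₁ (refl , refl , S₁≅S) = unary-principal r π ih S₁≅S
  ... | inj₂ (R , S₁≅ , S≅)       = unary-context r π (ih π (premise<unary r π)) S₁≅ S≅

  binary-invertible : ∀ {q B B₁ B₂ S₁} (r : BinaryRule q B B₁ B₂) (π₁ : LKm (add q B₁ S₁)) (π₂ : LKm (add q B₂ S₁)) →
    InvertibleBelow (size (binary r π₁ π₂)) → Invertible (binary r π₁ π₂)
  binary-invertible {q} {B} {B₁} {B₂} {S₁} r π₁ π₂ ih {S} e with add-≅-add {q} {p} {B} {¬' A} {S₁} {S} e
  ... | inj₁ (refl , refl , _) = ⊥-elim (¬-not-binary r)
  ... | inj₂ (R , S₁≅ , S≅)
    with ih π₁ (premise<binaryˡ r π₁ π₂) (add-cong-comm q B₁ p (¬' A) S₁≅)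
       | ih π₂ (premise<binaryʳ r π₁ π₂) (add-cong-comm q B₂ p (¬' A) S₁≅)
  ... | π₁' , M₁ , size₁ | π₂' , M₂ , size₂ =
    exchange (≅-sym (add-cong-comm (flip p) A q B S≅)) (binary r π₁'' π₂'') ,
    binary-mono r π₁ π₂ π₁'' π₂'' M₁ M₂ (ssize-add-mono q B (<⇒≤ (ssize-inverted p A R S₁≅))) size₁ size₂
    where
    π₁'' : LKm (add q B₁ (add (flip p) A R))
    π₁'' = exchange (add-comm (flip p) q A B₁ R) π₁'
    π₂'' : LKm (add q B₂ (add (flip p) A R))
    π₂'' = exchange (add-comm (flip p) q A B₂ R) π₂'

  cut-invertible : ∀ {S₁} s C (vc : V C ⊆ᵥ sideVars s S₁) (π₁ : LKm (addS s C S₁)) (π₂ : LKm (addA s C S₁)) →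
    InvertibleBelow (size (cut s C vc π₁ π₂)) → Invertible (cut s C vc π₁ π₂)
  cut-invertible {S₁} s C vc π₁ π₂ ih {S} e
    with ih π₁ (<ssize+ˡ S₁ (size π₁) (size π₂)) (add-cong-comm (s , succedent) C p (¬' A) e)
       | ih π₂ (<ssize+ʳ S₁ (size π₁) (size π₂)) (add-cong-comm (s , antecedent) C p (¬' A) e)
  ... | π₁' , M₁ , size₁ | π₂' , M₂ , size₂ =
    cut s C vc' (exchange (add-comm (flip p) (s , succedent) A C S) π₁')
                (exchange (add-comm (flip p) (s , antecedent) A C S) π₂') ,
    cong₂ (join s) M₁ M₂ ,
    +-mono-≤ (<⇒≤ (ssize-inverted p A S e)) (+-mono-≤ size₁ size₂)
    where
    vc' : V C ⊆ᵥ sideVars s (add (flip p) A S)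
    vc' x = ∈-resp-↭ (↭-trans (sideVars-≅ s e) (sideVars-flip s p A S)) (vc x)

  invertible-step : ∀ {T} (π : LKm T) → InvertibleBelow (size π) → Invertible π
  invertible-step (ax-ll _) _ e = ⊥-elim (¬'∉-atoms (∈-formulas p (¬' A) _ e))
  invertible-step (ax-rr _) _ e = ⊥-elim (¬'∉-atoms (∈-formulas p (¬' A) _ e))
  invertible-step (ax-lr _) _ e = ⊥-elim (¬'∉-atoms (∈-formulas p (¬' A) _ e))
  invertible-step (ax-rl _) _ e = ⊥-elim (¬'∉-atoms (∈-formulas p (¬' A) _ e))
  invertible-step ax⊥-l     _ e = ⊥-elim (¬'∉-⊥ (∈-formulas p (¬' A) _ e))
  invertible-step ax⊥-r     _ e = ⊥-elim (¬'∉-⊥ (∈-formulas p (¬' A) _ e))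
  invertible-step (exch g₁ g₂ d₁ d₂ π) ih e = invertible-step π ih (≅-trans (≅-fields g₁ g₂ d₁ d₂) e)
  invertible-step (wL s B π)         = unary-invertible (weakening   (s , antecedent) B) π
  invertible-step (wR s B π)         = unary-invertible (weakening   (s , succedent)  B) π
  invertible-step (cL s B π)         = unary-invertible (contraction (s , antecedent) B) π
  invertible-step (cR s B π)         = unary-invertible (contraction (s , succedent)  B) π
  invertible-step (L∧₁ s B C π)      = unary-invertible (∧-left₁ s B C) π
  invertible-step (L∧₂ s B C π)      = unary-invertible (∧-left₂ s B C) π
  invertible-step (R∨₁ s B C π)      = unary-invertible (∨-right₁ s B C) π
  invertible-step (R∨₂ s B C π)      = unary-invertible (∨-right₂ s B C) π
  invertible-step (L¬ s B π)         = unary-invertible (negation    (s , antecedent) B) π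
  invertible-step (R¬ s B π)         = unary-invertible (negation    (s , succedent)  B) π
  invertible-step (R∧ s B C π₁ π₂)   = binary-invertible (∧-right s B C) π₁ π₂
  invertible-step (L∨ s B C π₁ π₂)   = binary-invertible (∨-left  s B C) π₁ π₂
  invertible-step (cut s C vc π₁ π₂) = cut-invertible s C vc π₁ π₂

  -- Induction on length rather than on π: the contraction case inverts π₁,
  -- which is produced by the induction hypothesis and is not a subproof of π.
  invertible : ∀ {T} (π : LKm T) → Invertible π
  invertible π = invertible-acc π (<-wellFounded (size π))
    where
    invertible-acc : ∀ {T} (π : LKm T) → Acc _<_ (size π) → Invertible π
    invertible-acc π (acc rs) = invertible-step π λ π' lt → invertible-acc π' (rs lt)

lemma4p6 : (Γ₁ Γ₂ Δ₁ Δ₂ : List Formula) (A : Formula) →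
    ((π : LKm (Γ₁ ︔ Γ₂ ⇒ Δ₁ ︔ (¬' A ∷ Δ₂))) →
       Σ (LKm (Γ₁ ︔ (A ∷ Γ₂) ⇒ Δ₁ ︔ Δ₂)) λ π' → (M π' ≡ M π) × (size π' ≤ 2 * size π))
    × ((π : LKm (Γ₁ ︔ Γ₂ ⇒ (¬' A ∷ Δ₁) ︔ Δ₂)) →
       Σ (LKm ((A ∷ Γ₁) ︔ Γ₂ ⇒ Δ₁ ︔ Δ₂)) λ π' → (M π' ≡ M π) × (size π' ≤ 2 * size π))
    × ((π : LKm (Γ₁ ︔ (¬' A ∷ Γ₂) ⇒ Δ₁ ︔ Δ₂)) →
       Σ (LKm (Γ₁ ︔ Γ₂ ⇒ Δ₁ ︔ (A ∷ Δ₂))) λ π' → (M π' ≡ M π) × (size π' ≤ 2 * size π))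
    × ((π : LKm ((¬' A ∷ Γ₁) ︔ Γ₂ ⇒ Δ₁ ︔ Δ₂)) →
       Σ (LKm (Γ₁ ︔ Γ₂ ⇒ (A ∷ Δ₁) ︔ Δ₂)) λ π' → (M π' ≡ M π) × (size π' ≤ 2 * size π))
lemma4p6 Γ₁ Γ₂ Δ₁ Δ₂ A =
  invert (right , succedent) , invert (left , succedent) , invert (right , antecedent) , invert (left , antecedent)
  where
  S : SSeq
  S = Γ₁ ︔ Γ₂ ⇒ Δ₁ ︔ Δ₂
  invert : ∀ p (π : LKm (add p (¬' A) S)) →
    Σ (LKm (add (flip p) A S)) λ π' → M π' ≡ M π × size π' ≤ 2 * size π
  invert p π with ¬-Inversion.invertible p A π ≅-refl
  ... | π' , M≡ , size≤ = π' , M≡ , ≤-trans size≤ (m≤m+n (size π) _)
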